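{- For an integer $n\geq 1$ define the polynomial in $x$ \begin{align*} \psi^{(n,n)}(x)=&(n+1)^2(n-x)^3(n-x+1)^3(2x+1)(2x-1)\\ &+(n+1)^2x^3(x+1)^3(2n-2x-1)(2n-2x+1)\\ &-2n^2(n-x+1)^3(x+1)^3(2n-2x-1)(2x-1). \end{align*} Then for every integer $n\geq 2$ there exists an index $k'$ (depending on $n$) such that $\psi^{(n,n)}(k)\geq 0$ for all integers $1\leq k\leq k'$ and $\psi^{(n,n)}(k)\leq 0$ for all integers $k'<k\leq n/2$. -}

module Defs where

open import Data.Integer using (ℤ; +_; _+_; _-_; _*_; _^_)

ψ : ℤ → ℤ → ℤ
ψ n x =
    (n + + 1) ^ 2 * (n - x) ^ 3 * (n - x + + 1) ^ 3 * (+ 2 * x + + 1) * (+ 2 * x - + 1)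
  + (n + + 1) ^ 2 * x ^ 3 * (x + + 1) ^ 3 * (+ 2 * n - + 2 * x - + 1) * (+ 2 * n - + 2 * x + + 1)
  - + 2 * n ^ 2 * (n - x + + 1) ^ 3 * (x + + 1) ^ 3 * (+ 2 * n - + 2 * x - + 1) * (+ 2 * x - + 1)

-- Put w(n,k) = (k(n−k))³, which is positive for 1 ≤ k < n.  The key
-- fact is that the ratio ψ(n,k) / w(n,k) is non-increasing in k on
-- 1 ≤ k ≤ n/2, in the cross-multiplied form
--     ψ(n,k+1) · w(n,k)  ≤  ψ(n,k) · w(n,k+1)     (1 ≤ k, 2(k+1) ≤ n).
-- Writing k = a+1 and n = 2a+d+4 with a, d ≥ 0, the difference of the two
-- sides becomes a polynomial in (a, d) all of whose coefficients are
-- non-negative; this is checked by computing its normal form.  Hence once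
-- ψ(n,k) < 0 it stays negative up to n/2, and a general "threshold" lemma
-- for such persistent decidable properties yields the index k′.
module Submission where

open import Defs
open import Data.Integer using (ℤ; +_; -[1+_]; _+_; _-_; -_; _*_; _^_; _≤_; _<_; +≤+; +<+; -<+; _<?_)
open import Data.Integer.Properties using (+-identityˡ; *-zeroʳ; +-mono-≤; pos-*; ≤-<-trans; <-irrefl; *-monoʳ-<-pos; 0≤i-j⇒j≤i; ≮⇒≥; <⇒≤; drop‿+≤+)
open import Data.Integer.Properties using () renaming (+-identityʳ to ℤ-+-identityʳ)
open import Data.Integer.Tactic.RingSolver using (solve-∀)
import Data.Nat as ℕ
open import Data.Nat using (ℕ; zero; suc; z≤n; s≤s; ⌊_/2⌋; ⌈_/2⌉)
open import Data.Nat.Properties using (≤-refl; ≤-trans; m≤n⇒m<n∨m≡n; m≤n⇒m≤1+n; m+[n∸m]≡n; +-identityʳ; ⌊n/2⌋-mono; n≡⌊n+n/2⌋; ⌊n/2⌋≤⌈n/2⌉; ⌊n/2⌋+⌈n/2⌉≡n)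
import Data.Nat.Properties as ℕP
import Data.Nat.Tactic.RingSolver as ℕSolver
open import Data.Bool using (Bool; true; false; T; _∧_)
open import Data.Bool.Properties using (T-∧)
open import Data.List using (List; []; _∷_)
open import Data.Product using (∃-syntax; _×_; _,_; proj₁; proj₂)
open import Data.Sum using (inj₁; inj₂)
open import Data.Unit using (tt)
open import Function.Bundles using (Equivalence)
open import Relation.Nullary using (¬_; yes; no; contradiction)
open import Relation.Unary using (Decidable)
open import Relation.Binary.PropositionalEquality using (_≡_; refl; sym; cong; subst)

0≤i*j : ∀ {i j : ℤ} → + 0 ≤ i → + 0 ≤ j → + 0 ≤ i * j
0≤i*j {+ m} {+ n} _ _ = subst (+ 0 ≤_) (pos-* m n) (+≤+ z≤n)

record Coefficients (C : Set) : Set where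
  field
    const        : ℤ → C
    zero#        : C
    _⊕_ _⊗_      : C → C → C
    ⊝_           : C → C
    nonNegative? : C → Bool

  _⊛_ : C → ℕ → C
  c ⊛ zero  = const (+ 1)
  c ⊛ suc m = c ⊗ (c ⊛ m)

record Interpretation {C : Set} (K : Coefficients C) (⟦_⟧ : C → ℤ) : Set where
  open Coefficients K
  field
    ⟦const⟧        : ∀ z → ⟦ const z ⟧ ≡ z
    ⟦zero⟧         : ⟦ zero# ⟧ ≡ + 0
    ⟦⊕⟧            : ∀ c d → ⟦ c ⊕ d ⟧ ≡ ⟦ c ⟧ + ⟦ d ⟧
    ⟦⊗⟧            : ∀ c d → ⟦ c ⊗ d ⟧ ≡ ⟦ c ⟧ * ⟦ d ⟧
    ⟦⊝⟧            : ∀ c → ⟦ ⊝ c ⟧ ≡ - ⟦ c ⟧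
    nonNegative-ok : ∀ c → T (nonNegative? c) → + 0 ≤ ⟦ c ⟧

  ⟦⊛⟧ : ∀ c m → ⟦ c ⊛ m ⟧ ≡ ⟦ c ⟧ ^ m
  ⟦⊛⟧ c zero    = ⟦const⟧ (+ 1)
  ⟦⊛⟧ c (suc m) rewrite ⟦⊗⟧ c (c ⊛ m) | ⟦⊛⟧ c m = refl

integers : Coefficients ℤ
integers = record
  { const = λ z → z ; zero# = + 0 ; _⊕_ = _+_ ; _⊗_ = _*_ ; ⊝_ = -_
  ; nonNegative? = λ { (+ _) → true ; -[1+ _ ] → false } }

integers-identity : Interpretation integers (λ z → z)
integers-identity = record
  { ⟦const⟧ = λ _ → refl ; ⟦zero⟧ = refl ; ⟦⊕⟧ = λ _ _ → refl
  ; ⟦⊗⟧ = λ _ _ → refl ; ⟦⊝⟧ = λ _ → refl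
  ; nonNegative-ok = λ { (+ _) _ → +≤+ z≤n } }

-- Polynomials in one indeterminate over K, as dense coefficient lists
-- (constant term first).
module Dense {C : Set} (K : Coefficients C) where
  open Coefficients K

  add : List C → List C → List C
  add []      q       = q
  add (c ∷ p) []      = c ∷ p
  add (c ∷ p) (d ∷ q) = (c ⊕ d) ∷ add p q

  scale : C → List C → List C
  scale c []      = []
  scale c (d ∷ q) = (c ⊗ d) ∷ scale c q

  negate : List C → List C
  negate []      = []
  negate (c ∷ p) = (⊝ c) ∷ negate p

  multiply : List C → List C → List C
  multiply []      q = []
  multiply (c ∷ p) q = add (scale c q) (zero# ∷ multiply p q)

  allNonNegative? : List C → Bool
  allNonNegative? []      = true
  allNonNegative? (c ∷ p) = nonNegative? c ∧ allNonNegative? p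

  polynomials : Coefficients (List C)
  polynomials = record
    { const = λ z → const z ∷ [] ; zero# = [] ; _⊕_ = add ; _⊗_ = multiply
    ; ⊝_ = negate ; nonNegative? = allNonNegative? }

  indeterminate : List C
  indeterminate = zero# ∷ const (+ 1) ∷ []

  module Evaluation {⟦_⟧ : C → ℤ} (I : Interpretation K ⟦_⟧) (t : ℤ) (0≤t : + 0 ≤ t) where
    open Interpretation I

    eval : List C → ℤ
    eval []      = + 0
    eval (c ∷ p) = ⟦ c ⟧ + t * eval p

    eval-add : ∀ p q → eval (add p q) ≡ eval p + eval q
    eval-add []      q       = sym (+-identityˡ (eval q))
    eval-add (c ∷ p) []      = sym (ℤ-+-identityʳ (eval (c ∷ p)))
    eval-add (c ∷ p) (d ∷ q) rewrite ⟦⊕⟧ c d | eval-add p q = regroup ⟦ c ⟧ ⟦ d ⟧ (eval p) (eval q) t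
      where regroup : ∀ c d x y t → (c + d) + t * (x + y) ≡ (c + t * x) + (d + t * y)
            regroup = solve-∀

    eval-scale : ∀ c q → eval (scale c q) ≡ ⟦ c ⟧ * eval q
    eval-scale c []      = sym (*-zeroʳ ⟦ c ⟧)
    eval-scale c (d ∷ q) rewrite ⟦⊗⟧ c d | eval-scale c q = factor ⟦ c ⟧ ⟦ d ⟧ (eval q) t
      where factor : ∀ c d x t → c * d + t * (c * x) ≡ c * (d + t * x)
            factor = solve-∀

    eval-negate : ∀ p → eval (negate p) ≡ - eval p
    eval-negate []      = refl
    eval-negate (c ∷ p) rewrite ⟦⊝⟧ c | eval-negate p = factor ⟦ c ⟧ (eval p) t
      where factor : ∀ c x t → - c + t * (- x) ≡ - (c + t * x)
            factor = solve-∀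

    eval-multiply : ∀ p q → eval (multiply p q) ≡ eval p * eval q
    eval-multiply []      q = refl
    eval-multiply (c ∷ p) q
      rewrite eval-add (scale c q) (zero# ∷ multiply p q) | eval-scale c q
            | ⟦zero⟧ | eval-multiply p q = factor ⟦ c ⟧ (eval p) (eval q) t
      where factor : ∀ c x y t → c * y + (+ 0 + t * (x * y)) ≡ (c + t * x) * y
            factor = solve-∀

    eval-nonNegative : ∀ p → T (allNonNegative? p) → + 0 ≤ eval p
    eval-nonNegative []      _  = +≤+ z≤n
    eval-nonNegative (c ∷ p) ok =
      +-mono-≤ (nonNegative-ok c (proj₁ split)) (0≤i*j 0≤t (eval-nonNegative p (proj₂ split)))
      where split : T (nonNegative? c) × T (allNonNegative? p)
            split = Equivalence.to T-∧ ok

    eval-indeterminate : eval indeterminate ≡ t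
    eval-indeterminate rewrite ⟦zero⟧ | ⟦const⟧ (+ 1) = linear t
      where linear : ∀ t → + 0 + t * (+ 1 + t * + 0) ≡ t
            linear = solve-∀

    polynomials-interpretation : Interpretation polynomials eval
    polynomials-interpretation = record
      { ⟦const⟧ = eval-const ; ⟦zero⟧ = refl ; ⟦⊕⟧ = eval-add ; ⟦⊗⟧ = eval-multiply
      ; ⟦⊝⟧ = eval-negate ; nonNegative-ok = eval-nonNegative }
      where
      eval-const : ∀ z → eval (const z ∷ []) ≡ z
      eval-const z rewrite ⟦const⟧ z = right-unit z t
        where right-unit : ∀ z t → z + t * + 0 ≡ z
              right-unit = solve-∀

data Expr : Set where
  var₁ var₂ : Expr
  con       : ℤ → Expr
  _:+_ _:-_ _:*_ : Expr → Expr → Expr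
  _:^_      : Expr → ℕ → Expr

infixl 6 _:+_ _:-_
infixl 7 _:*_
infixr 8 _:^_

⟦_⟧ᵉ : Expr → ℤ → ℤ → ℤ
⟦ var₁ ⟧ᵉ   a d = a
⟦ var₂ ⟧ᵉ   a d = d
⟦ con z ⟧ᵉ  a d = z
⟦ e :+ f ⟧ᵉ a d = ⟦ e ⟧ᵉ a d + ⟦ f ⟧ᵉ a d
⟦ e :- f ⟧ᵉ a d = ⟦ e ⟧ᵉ a d - ⟦ f ⟧ᵉ a d
⟦ e :* f ⟧ᵉ a d = ⟦ e ⟧ᵉ a d * ⟦ f ⟧ᵉ a d
⟦ e :^ m ⟧ᵉ a d = ⟦ e ⟧ᵉ a d ^ m

-- Bivariate normal forms: polynomials in a whose coefficients are
-- polynomials in d.  Normalisation does not depend on the point.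
module Inner = Dense integers
module Outer = Dense Inner.polynomials
open Coefficients Outer.polynomials using (_⊛_)

Bivariate : Set
Bivariate = List (List ℤ)

normalise : Expr → Bivariate
normalise var₁     = Outer.indeterminate
normalise var₂     = Inner.indeterminate ∷ []
normalise (con z)  = (z ∷ []) ∷ []
normalise (e :+ f) = Outer.add (normalise e) (normalise f)
normalise (e :- f) = Outer.add (normalise e) (Outer.negate (normalise f))
normalise (e :* f) = Outer.multiply (normalise e) (normalise f)
normalise (e :^ m) = normalise e ⊛ m

nonNegative-by-coefficients : ∀ e → T (Outer.allNonNegative? (normalise e)) →
  ∀ (a d : ℕ) → + 0 ≤ ⟦ e ⟧ᵉ (+ a) (+ d)
nonNegative-by-coefficients e certificate a d =
  subst (+ 0 ≤_) (normalise-sound e) (OuterEval.eval-nonNegative (normalise e) certificate)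
  where
  module InnerEval = Inner.Evaluation integers-identity (+ d) (+≤+ z≤n)
  module OuterEval = Outer.Evaluation InnerEval.polynomials-interpretation (+ a) (+≤+ z≤n)
  open Interpretation OuterEval.polynomials-interpretation using (⟦const⟧; ⟦⊛⟧)
  open OuterEval using (eval; eval-add; eval-negate; eval-multiply)

  normalise-sound : ∀ e → eval (normalise e) ≡ ⟦ e ⟧ᵉ (+ a) (+ d)
  normalise-sound var₁     = OuterEval.eval-indeterminate
  normalise-sound var₂     rewrite InnerEval.eval-indeterminate = right-unit (+ d) (+ a)
    where right-unit : ∀ d a → d + a * + 0 ≡ d
          right-unit = solve-∀
  normalise-sound (con z)  = ⟦const⟧ z
  normalise-sound (e :+ f) rewrite eval-add (normalise e) (normalise f)
                                 | normalise-sound e | normalise-sound f = refl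
  normalise-sound (e :- f) rewrite eval-add (normalise e) (Outer.negate (normalise f))
                                 | eval-negate (normalise f)
                                 | normalise-sound e | normalise-sound f = refl
  normalise-sound (e :* f) rewrite eval-multiply (normalise e) (normalise f)
                                 | normalise-sound e | normalise-sound f = refl
  normalise-sound (e :^ m) rewrite ⟦⊛⟧ (normalise e) m | normalise-sound e = refl

ψᵉ : Expr → Expr → Expr
ψᵉ n x =
    (n :+ con (+ 1)) :^ 2 :* (n :- x) :^ 3 :* (n :- x :+ con (+ 1)) :^ 3
      :* (con (+ 2) :* x :+ con (+ 1)) :* (con (+ 2) :* x :- con (+ 1))
  :+ (n :+ con (+ 1)) :^ 2 :* x :^ 3 :* (x :+ con (+ 1)) :^ 3
      :* (con (+ 2) :* n :- con (+ 2) :* x :- con (+ 1)) :* (con (+ 2) :* n :- con (+ 2) :* x :+ con (+ 1))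
  :- con (+ 2) :* n :^ 2 :* (n :- x :+ con (+ 1)) :^ 3 :* (x :+ con (+ 1)) :^ 3
      :* (con (+ 2) :* n :- con (+ 2) :* x :- con (+ 1)) :* (con (+ 2) :* x :- con (+ 1))

-- The pairs 1 ≤ k, 2(k+1) ≤ n are exactly k = a+1, n = 2a+d+4 with a, d ∈ ℕ;
-- the weights k(n−k) and (k+1)(n−k−1) are written without subtraction.
nᵉ kᵉ k+1ᵉ weightᵉ weight+1ᵉ : Expr
nᵉ         = con (+ 4) :+ var₁ :+ var₁ :+ var₂
kᵉ         = con (+ 1) :+ var₁
k+1ᵉ       = con (+ 2) :+ var₁
weightᵉ    = kᵉ :* (con (+ 3) :+ var₁ :+ var₂)
weight+1ᵉ  = k+1ᵉ :* (con (+ 2) :+ var₁ :+ var₂)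

ratio-gapᵉ : Expr
ratio-gapᵉ = ψᵉ nᵉ kᵉ :* weight+1ᵉ :^ 3 :- ψᵉ nᵉ k+1ᵉ :* weightᵉ :^ 3

-- The key inequality ψ(n,k+1)·w(n,k) ≤ ψ(n,k)·w(n,k+1): the gap has
-- only non-negative coefficients as a polynomial in (a, d).
ψ-ratio-antitone : ∀ a d →
  ψ (+ (4 ℕ.+ a ℕ.+ a ℕ.+ d)) (+ (2 ℕ.+ a)) * (+ ((1 ℕ.+ a) ℕ.* (3 ℕ.+ a ℕ.+ d))) ^ 3
    ≤ ψ (+ (4 ℕ.+ a ℕ.+ a ℕ.+ d)) (+ (1 ℕ.+ a)) * (+ ((2 ℕ.+ a) ℕ.* (2 ℕ.+ a ℕ.+ d))) ^ 3
ψ-ratio-antitone a d = 0≤i-j⇒j≤i (nonNegative-by-coefficients ratio-gapᵉ tt a d)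

negative-by-comparison : ∀ {X Y U V : ℤ} → + 0 ≤ U → + 0 < V → Y * U ≤ X * V → X < + 0 → Y < + 0
negative-by-comparison {Y = -[1+ _ ]} _ _ _ _ = -<+
negative-by-comparison {V = + zero} _ (+<+ ()) _ _
negative-by-comparison {X} {+ y} {U} {+ suc v} 0≤U _ YU≤XV X<0 =
  contradiction (≤-<-trans (0≤i*j {+ y} (+≤+ z≤n) 0≤U) (≤-<-trans YU≤XV XV<0)) (<-irrefl refl)
  where XV<0 : X * + suc v < + 0
        XV<0 = *-monoʳ-<-pos (+ suc v) X<0

data Coordinates : ℕ → ℕ → Set where
  coordinates : ∀ a d → Coordinates (4 ℕ.+ a ℕ.+ a ℕ.+ d) (1 ℕ.+ a)

coordinates-of : ∀ {n k} → 1 ℕ.≤ k → 2 ℕ.* suc k ℕ.≤ n → Coordinates n k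
coordinates-of {n} {suc a} _ 2[k+1]≤n =
  subst (λ m → Coordinates m (suc a)) (m+[n∸m]≡n 4+2a≤n) (coordinates a (n ℕ.∸ (4 ℕ.+ a ℕ.+ a)))
  where
  double : ∀ a → 2 ℕ.* (2 ℕ.+ a) ≡ 4 ℕ.+ a ℕ.+ a
  double = ℕSolver.solve-∀
  4+2a≤n : 4 ℕ.+ a ℕ.+ a ℕ.≤ n
  4+2a≤n = subst (ℕ._≤ n) (double a) 2[k+1]≤n

negativity-persists : ∀ n k → 1 ℕ.≤ k → 2 ℕ.* suc k ℕ.≤ n →
  ψ (+ n) (+ k) < + 0 → ψ (+ n) (+ suc k) < + 0
negativity-persists n k 1≤k 2[k+1]≤n with coordinates-of 1≤k 2[k+1]≤n
... | coordinates a d = negative-by-comparison (+≤+ z≤n) (+<+ (s≤s z≤n)) (ψ-ratio-antitone a d)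

persists : ∀ {P : ℕ → Set} {m} → (∀ {j} → 1 ℕ.≤ j → suc j ℕ.≤ m → P j → P (suc j)) →
  ∀ {j k} → 1 ℕ.≤ j → j ℕ.≤ k → k ℕ.≤ m → P j → P k
persists step {j} {k} 1≤j j≤k k≤m Pj with m≤n⇒m<n∨m≡n j≤k
... | inj₂ refl = Pj
... | inj₁ (s≤s {n = k₀} j≤k₀) = step (≤-trans 1≤j j≤k₀) k≤m (persists step 1≤j j≤k₀ (ℕP.<⇒≤ k≤m) Pj)

threshold : ∀ {P : ℕ → Set} → Decidable P → ∀ m →
  (∀ {j} → 1 ℕ.≤ j → suc j ℕ.≤ m → P j → P (suc j)) →
  ∃[ k′ ] ((∀ {j} → 1 ℕ.≤ j → j ℕ.≤ k′ → ¬ P j) × (∀ {j} → k′ ℕ.< j → j ℕ.≤ m → P j))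
threshold P? zero step = 0 , (λ { (s≤s _) () }) , (λ { (s≤s _) () })
threshold {P} P? (suc m) step with threshold P? m (λ 1≤j j<m → step 1≤j (m≤n⇒m≤1+n j<m)) | P? (suc m)
... | k′ , fails , holds | yes Pm+1 = k′ , fails , holds′
  where
  holds′ : ∀ {j} → k′ ℕ.< j → j ℕ.≤ suc m → P j
  holds′ k′<j j≤m+1 with m≤n⇒m<n∨m≡n j≤m+1
  ... | inj₁ (s≤s j≤m) = holds k′<j j≤m
  ... | inj₂ refl      = Pm+1
... | _ | no ¬Pm+1 = suc m , (λ 1≤j j≤m+1 Pj → ¬Pm+1 (persists step 1≤j j≤m+1 ≤-refl Pj))
                           , (λ m+1<j j≤m+1 → contradiction (≤-trans m+1<j j≤m+1) (ℕP.n≮n (suc m)))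

2*-≡-+ : ∀ j → 2 ℕ.* j ≡ j ℕ.+ j
2*-≡-+ j = cong (j ℕ.+_) (+-identityʳ j)

2*≤⇒≤⌊/2⌋ : ∀ {j n} → 2 ℕ.* j ℕ.≤ n → j ℕ.≤ ⌊ n /2⌋
2*≤⇒≤⌊/2⌋ {j} {n} 2j≤n =
  subst (ℕ._≤ ⌊ n /2⌋) (sym (n≡⌊n+n/2⌋ j)) (⌊n/2⌋-mono (subst (ℕ._≤ n) (2*-≡-+ j) 2j≤n))

≤⌊/2⌋⇒2*≤ : ∀ {j n} → j ℕ.≤ ⌊ n /2⌋ → 2 ℕ.* j ℕ.≤ n
≤⌊/2⌋⇒2*≤ {j} {n} j≤⌊n/2⌋ = begin
  2 ℕ.* j             ≡⟨ 2*-≡-+ j ⟩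
  j ℕ.+ j             ≤⟨ ℕP.+-mono-≤ j≤⌊n/2⌋ (≤-trans j≤⌊n/2⌋ (⌊n/2⌋≤⌈n/2⌉ n)) ⟩
  ⌊ n /2⌋ ℕ.+ ⌈ n /2⌉ ≡⟨ ⌊n/2⌋+⌈n/2⌉≡n n ⟩
  n                   ∎
  where open ℕP.≤-Reasoning

-- Apply the threshold lemma to "ψ(n,k) < 0" on [1, ⌊n/2⌋]; negativity
-- propagates there by the monotonicity of ψ(n,k)/(k(n−k))³.
proposition3p5 : (n : ℤ) → + 2 ≤ n →
    ∃[ k′ ] (((k : ℤ) → + 1 ≤ k → k ≤ k′ → + 0 ≤ ψ n k)
          × ((k : ℤ) → k′ < k → + 2 * k ≤ n → ψ n k ≤ + 0))
proposition3p5 (+ n) (+≤+ _)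
  with threshold (λ j → ψ (+ n) (+ j) <? + 0) ⌊ n /2⌋
                 (λ 1≤j k<⌊n/2⌋ → negativity-persists n _ 1≤j (≤⌊/2⌋⇒2*≤ k<⌊n/2⌋))
... | k′ , nonNegative , negative = + k′ , initial , final
  where
  initial : (k : ℤ) → + 1 ≤ k → k ≤ + k′ → + 0 ≤ ψ (+ n) k
  initial (+ j) (+≤+ 1≤j) (+≤+ j≤k′) = ≮⇒≥ (nonNegative 1≤j j≤k′)

  final : (k : ℤ) → + k′ < k → + 2 * k ≤ + n → ψ (+ n) k ≤ + 0
  final (+ j) (+<+ k′<j) 2k≤n =
    <⇒≤ (negative k′<j (2*≤⇒≤⌊/2⌋ (drop‿+≤+ (subst (_≤ + n) (sym (pos-* 2 j)) 2k≤n))))
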